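{- Suppose $(U,\mathcal S,\mathcal C)$ is a complete Mammen space. Then: (a) a set $X\subseteq U$ contains no non-empty set belonging to $\mathcal S$ if and only if $X\in\mathcal C$; (b) $\mathcal C$ is an ideal, consisting precisely of the subsets of $U$ with empty interior in the topology $\mathcal S$; (c) $\mathrm{ND}(\mathcal S)\subseteq\mathcal C$, where $\mathrm{ND}(\mathcal S)$ is the family of nowhere dense subsets of $U$ with respect to $\mathcal S$.
   Context: A \emph{Mammen space} is a triple $(U,\mathcal S,\mathcal C)$ where $U\neq\emptyset$ and $\mathcal S,\mathcal C\subseteq\mathcal P(U)$ satisfy: (1) $\mathcal S$ is a Hausdorff topology on $U$ in which every non-empty open set is infinite; (2) there is a non-empty $C\in\mathcal C$, $\mathcal C$ is closed under finite unions and finite intersections, and every non-empty $C\in\mathcal C$ contains some $x$ with $\{x\}\in\mathcal C$; (3) $\mathcal S\cap\mathcal C=\{\emptyset\}$, and $C\cap S\in\mathcal C$ for $C\in\mathcal C$, $S\in\mathcal S$. It is \emph{complete} if every $X\subseteq U$ can be written as $X=S\cup C$ with $S\in\mathcal S$, $C\in\mathcal C$. -}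

module Defs where

open import Level using (Level; suc; _⊔_) renaming (zero to 0ℓ)
open import Data.Product using (Σ; ∃; ∃-syntax; _×_; _,_)
open import Data.Sum using (_⊎_)
open import Data.Empty using (⊥)
open import Data.List using (List)
open import Data.List.Membership.Propositional using (_∈_)
open import Relation.Nullary using (¬_)
open import Relation.Binary.PropositionalEquality using (_≡_)

Subset : Set → Set₁
Subset U = U → Set

Family : Set → Set₂
Family U = Subset U → Set₁

module _ {U : Set} where

  ∅ₛ : Subset U
  ∅ₛ _ = ⊥

  Univ : Subset U
  Univ _ = Data.Unit.⊤ where import Data.Unit

  _⊆_ : Subset U → Subset U → Set
  A ⊆ B = ∀ x → A x → B x

  _≐_ : Subset U → Subset U → Set
  A ≐ B = (A ⊆ B) × (B ⊆ A)

  _∪_ : Subset U → Subset U → Subset U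
  (A ∪ B) x = A x ⊎ B x

  _∩_ : Subset U → Subset U → Subset U
  (A ∩ B) x = A x × B x

  ∁ : Subset U → Subset U
  ∁ A x = ¬ A x

  ｛_｝ : U → Subset U
  ｛ x ｝ y = y ≡ x

  NonEmpty : Subset U → Set
  NonEmpty A = ∃[ x ] A x

  IsEmpty : Subset U → Set
  IsEmpty A = ∀ x → ¬ A x

  Finite : Subset U → Set
  Finite A = ∃[ xs ] (∀ x → A x → x ∈ xs)

  Infinite : Subset U → Set
  Infinite A = ¬ Finite A

  Extensional : Family U → Set₁
  Extensional 𝓕 = ∀ A B → A ≐ B → 𝓕 A → 𝓕 B

  record IsTopology (𝓢 : Family U) : Set₂ where
    field
      ext      : Extensional 𝓢
      empty∈   : 𝓢 ∅ₛ
      univ∈    : 𝓢 Univ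
      ∩-closed : ∀ A B → 𝓢 A → 𝓢 B → 𝓢 (A ∩ B)
      ⋃-closed : (I : Set) (A : I → Subset U) → (∀ i → 𝓢 (A i)) →
                 𝓢 (λ x → ∃[ i ] A i x)

  IsHausdorff : Family U → Set₁
  IsHausdorff 𝓢 = ∀ x y → ¬ x ≡ y →
    ∃[ A ] ∃[ B ] (𝓢 A × 𝓢 B × A x × B y × IsEmpty (A ∩ B))

  interior : Family U → Subset U → U → Set₁
  interior 𝓢 X x = ∃[ A ] (𝓢 A × A ⊆ X × A x)

  IsClosed : Family U → Subset U → Set₁
  IsClosed 𝓢 F = 𝓢 (∁ F)

  closure : Family U → Subset U → U → Set₁
  closure 𝓢 X x = ∀ F → IsClosed 𝓢 F → X ⊆ F → F x

  EmptyInterior : Family U → Subset U → Set₁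
  EmptyInterior 𝓢 X = ∀ x → ¬ interior 𝓢 X x

  -- nowhere dense: the closure has empty interior
  -- (interior of the closure: union of open sets contained in the closure)
  NowhereDense : Family U → Subset U → Set₁
  NowhereDense 𝓢 X = ∀ x → ¬ (∃[ A ] (𝓢 A × (∀ y → A y → closure 𝓢 X y) × A x))

  record IsIdeal (𝓒 : Family U) : Set₂ where
    field
      empty∈     : 𝓒 ∅ₛ
      hereditary : ∀ A B → A ⊆ B → 𝓒 B → 𝓒 A
      ∪-closed   : ∀ A B → 𝓒 A → 𝓒 B → 𝓒 (A ∪ B)

  record IsMammenSpace (𝓢 𝓒 : Family U) : Set₂ where
    field
      topology   : IsTopology 𝓢
      hausdorff  : IsHausdorff 𝓢
      openInfinite : ∀ A → 𝓢 A → NonEmpty A → Infinite A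
      𝓒-ext      : Extensional 𝓒
      nonEmptyC  : ∃[ C ] (𝓒 C × NonEmpty C)
      ∪-closed   : ∀ A B → 𝓒 A → 𝓒 B → 𝓒 (A ∪ B)
      ∩-closed   : ∀ A B → 𝓒 A → 𝓒 B → 𝓒 (A ∩ B)
      singleton  : ∀ C → 𝓒 C → NonEmpty C → ∃[ x ] (C x × 𝓒 ｛ x ｝)
      empty∈𝓢∩𝓒 : 𝓢 ∅ₛ × 𝓒 ∅ₛ
      𝓢∩𝓒-empty  : ∀ A → 𝓢 A → 𝓒 A → IsEmpty A
      C∩S∈𝓒      : ∀ C S → 𝓒 C → 𝓢 S → 𝓒 (C ∩ S)

  IsComplete : Family U → Family U → Set₁
  IsComplete 𝓢 𝓒 = ∀ X → ∃[ S ] ∃[ C ] (𝓢 S × 𝓒 C × X ≐ (S ∪ C))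

  NoNonEmptyOpenSubset : Family U → Subset U → Set₁
  NoNonEmptyOpenSubset 𝓢 X = ¬ (∃[ S ] (𝓢 S × S ⊆ X × NonEmpty S))

{-# OPTIONS --safe #-}
-- Completeness writes X = S ∪ C with S open and C ∈ 𝓒; if X contains no non-empty open
-- set then S = ∅ and X = C. Conversely, if X ∈ 𝓒 and S ⊆ X is open, then S = X ∩ S lies
-- in 𝓒 as well as in 𝓢, so S = ∅. Hence 𝓒 consists exactly of the sets with empty
-- interior; that family is hereditary (so 𝓒 is an ideal) and contains every nowhere
-- dense set, since X is contained in its closure.
module Submission where

open import Defs
open import Data.Product using (_×_; _,_; proj₂)
open import Data.Sum using (inj₁; inj₂)
open import Data.Empty using (⊥-elim)
open import Function.Base using (_∘_)
open import Function.Bundles using (_⇔_; mk⇔; Equivalence)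

module _ {U : Set} where

  ⊆-closure : (𝓢 : Family U) (X : Subset U) → ∀ x → X x → closure 𝓢 X x
  ⊆-closure 𝓢 X x Xx F _ X⊆F = X⊆F x Xx

  module _ (𝓢 : Family U) where

    noNonEmptyOpenSubset-⊆ : ∀ {A B} → A ⊆ B →
      NoNonEmptyOpenSubset 𝓢 B → NoNonEmptyOpenSubset 𝓢 A
    noNonEmptyOpenSubset-⊆ A⊆B noB (S , S∈𝓢 , S⊆A , S≠∅) =
      noB (S , S∈𝓢 , (λ y Sy → A⊆B y (S⊆A y Sy)) , S≠∅)

    noNonEmptyOpenSubset⇔emptyInterior : ∀ X →
      NoNonEmptyOpenSubset 𝓢 X ⇔ EmptyInterior 𝓢 X
    noNonEmptyOpenSubset⇔emptyInterior X = mk⇔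
      (λ noX x (S , S∈𝓢 , S⊆X , Sx) → noX (S , S∈𝓢 , S⊆X , (x , Sx)))
      (λ empty (S , S∈𝓢 , S⊆X , (x , Sx)) → empty x (S , S∈𝓢 , S⊆X , Sx))

    nowhereDense⇒noNonEmptyOpenSubset : ∀ X →
      NowhereDense 𝓢 X → NoNonEmptyOpenSubset 𝓢 X
    nowhereDense⇒noNonEmptyOpenSubset X nd (S , S∈𝓢 , S⊆X , (x , Sx)) =
      nd x (S , S∈𝓢 , (λ y Sy → ⊆-closure 𝓢 X y (S⊆X y Sy)) , Sx)

  module _ {𝓢 𝓒 : Family U} (M : IsMammenSpace 𝓢 𝓒) where
    open IsMammenSpace M

    𝓒⇒noNonEmptyOpenSubset : ∀ X → 𝓒 X → NoNonEmptyOpenSubset 𝓢 X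
    𝓒⇒noNonEmptyOpenSubset X X∈𝓒 (S , S∈𝓢 , S⊆X , (x , Sx)) =
      𝓢∩𝓒-empty S S∈𝓢 S∈𝓒 x Sx
      where
      X∩S≐S : (X ∩ S) ≐ S
      X∩S≐S = (λ _ → proj₂) , (λ y Sy → S⊆X y Sy , Sy)

      S∈𝓒 : 𝓒 S
      S∈𝓒 = 𝓒-ext (X ∩ S) S X∩S≐S (C∩S∈𝓒 X S X∈𝓒 S∈𝓢)

    noNonEmptyOpenSubset⇒𝓒 : IsComplete 𝓢 𝓒 →
      ∀ X → NoNonEmptyOpenSubset 𝓢 X → 𝓒 X
    noNonEmptyOpenSubset⇒𝓒 complete X noX with complete X
    ... | S , C , S∈𝓢 , C∈𝓒 , (X⊆S∪C , S∪C⊆X) =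
      𝓒-ext C X ((λ x Cx → S∪C⊆X x (inj₂ Cx)) , λ x Xx → inC x (X⊆S∪C x Xx)) C∈𝓒
      where
      inC : ∀ x → (S ∪ C) x → C x
      inC x (inj₁ Sx) = ⊥-elim (noX (S , S∈𝓢 , (λ y Sy → S∪C⊆X y (inj₁ Sy)) , (x , Sx)))
      inC x (inj₂ Cx) = Cx

    module _ (complete : IsComplete 𝓢 𝓒) where

      noNonEmptyOpenSubset⇔𝓒 : ∀ X → NoNonEmptyOpenSubset 𝓢 X ⇔ 𝓒 X
      noNonEmptyOpenSubset⇔𝓒 X =
        mk⇔ (noNonEmptyOpenSubset⇒𝓒 complete X) (𝓒⇒noNonEmptyOpenSubset X)

      𝓒-isIdeal : IsIdeal 𝓒
      𝓒-isIdeal = record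
        { empty∈     = proj₂ empty∈𝓢∩𝓒
        ; hereditary = λ A B A⊆B B∈𝓒 → noNonEmptyOpenSubset⇒𝓒 complete A
            (noNonEmptyOpenSubset-⊆ 𝓢 A⊆B (𝓒⇒noNonEmptyOpenSubset B B∈𝓒))
        ; ∪-closed   = ∪-closed
        }

      𝓒⇔emptyInterior : ∀ X → 𝓒 X ⇔ EmptyInterior 𝓢 X
      𝓒⇔emptyInterior X = mk⇔
        (Equivalence.to noOpen⇔empty ∘ 𝓒⇒noNonEmptyOpenSubset X)
        (noNonEmptyOpenSubset⇒𝓒 complete X ∘ Equivalence.from noOpen⇔empty)
        where
        noOpen⇔empty : NoNonEmptyOpenSubset 𝓢 X ⇔ EmptyInterior 𝓢 X
        noOpen⇔empty = noNonEmptyOpenSubset⇔emptyInterior 𝓢 X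

mainTheorem4 : (U : Set) (𝓢 𝓒 : Family U) →
    IsMammenSpace 𝓢 𝓒 → IsComplete 𝓢 𝓒 →
      ((X : Subset U) → NoNonEmptyOpenSubset 𝓢 X ⇔ 𝓒 X)
      × (IsIdeal 𝓒 × ((X : Subset U) → 𝓒 X ⇔ EmptyInterior 𝓢 X))
      × ((X : Subset U) → NowhereDense 𝓢 X → 𝓒 X)
mainTheorem4 U 𝓢 𝓒 M complete =
  noNonEmptyOpenSubset⇔𝓒 M complete ,
  (𝓒-isIdeal M complete , 𝓒⇔emptyInterior M complete) ,
  λ X → noNonEmptyOpenSubset⇒𝓒 M complete X ∘ nowhereDense⇒noNonEmptyOpenSubset 𝓢 X
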